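{- Let $d\ge2$, $\alpha=\frac{d+\sqrt{d^2+4}}{2}$, and let $(A_{m,n})_{m,n\ge1}$ be the $d$-Ostrowski array. For every fixed $m\ge1$, the differences $A_{m,n+1}-\alpha A_{m,n}$ ($n\ge1$) are nonzero, have alternating signs, and each has absolute value equal to $\frac1\alpha$ times the absolute value of the previous one; i.e. $A_{m,n+2}-\alpha A_{m,n+1}=-\frac1\alpha\,(A_{m,n+1}-\alpha A_{m,n})$ for all $n\ge1$.
   Context: Define $(D_n)$ by $D_0=0$, $D_1=1$, $D_{n+1}=dD_n+D_{n-1}$. An Ostrowski word is a finite word $d_1\cdots d_i$ over $\{0,\dots,d\}$ with $0\le d_1<d$, $0\le d_j\le d$ for $j>1$, and $d_{j-1}=0$ whenever $d_j=d$; it represents $\sum_j d_jD_j$. Every non-negative integer has a unique Ostrowski word with nonzero last digit. An Ostrowski word is trimmed if its last digit is nonzero and it cannot be written as $0v$ with $v$ an Ostrowski word (equivalently, its first digit is nonzero, or its first two digits are $0$ and $d$). Let $w_1,w_2,w_3,\dots$ be the trimmed Ostrowski words listed in increasing order of the integers they represent (so $w_1=1$). The $d$-Ostrowski array is $A_{m,n}=$ the integer represented by the word $0^{n-1}w_m$, for $m,n\ge1$. -}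

module Defs where

open import Data.Nat as ℕ using (ℕ; zero; suc; _<_; _≤_; _∸_)
open import Data.Integer as ℤ using (ℤ; +_; -_; _+_; _*_; _-_)
open import Data.List using (List; []; _∷_; replicate; _++_)
open import Data.Product using (_×_; ∃; _,_)
open import Data.Sum using (_⊎_)
open import Data.Unit using (⊤)
open import Data.Empty using (⊥)
open import Relation.Nullary using (¬_)
open import Relation.Binary.PropositionalEquality using (_≡_; _≢_)

Dseq : ℕ → ℕ → ℕ
Dseq d zero = 0
Dseq d (suc zero) = 1
Dseq d (suc (suc n)) = d ℕ.* Dseq d (suc n) ℕ.+ Dseq d n

-- Ostrowski words: a word d_1 ⋯ d_i is a list [d_1, …, d_i].

ValidTail : ℕ → ℕ → List ℕ → Set
ValidTail d prev [] = ⊤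
ValidTail d prev (y ∷ ys) = (y ≤ d) × (y ≡ d → prev ≡ 0) × ValidTail d y ys

OstrowskiWord : ℕ → List ℕ → Set
OstrowskiWord d [] = ⊤
OstrowskiWord d (x ∷ xs) = (x < d) × ValidTail d x xs

valueFrom : ℕ → ℕ → List ℕ → ℕ
valueFrom d j [] = 0
valueFrom d j (x ∷ xs) = x ℕ.* Dseq d j ℕ.+ valueFrom d (suc j) xs

value : ℕ → List ℕ → ℕ
value d w = valueFrom d 1 w

LastNonzero : List ℕ → Set
LastNonzero [] = ⊥
LastNonzero (x ∷ []) = x ≢ 0
LastNonzero (x ∷ y ∷ ys) = LastNonzero (y ∷ ys)

Trimmed : ℕ → List ℕ → Set
Trimmed d w = OstrowskiWord d w × LastNonzero w
            × ¬ (∃ λ v → (w ≡ 0 ∷ v) × OstrowskiWord d v)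

-- the array entry in the row of the trimmed word w, column n ≥ 1:
-- the integer represented by 0^{n-1} w
row : ℕ → List ℕ → ℕ → ℕ
row d w n = value d (replicate (n ∸ 1) 0 ++ w)

-- The ring ℤ[α], α = (d + √(d²+4))/2, realised as pairs a + bα
-- with α² = dα + 1 (the minimal polynomial of α).  Since α is
-- irrational, a + bα = 0 in ℝ iff a = b = 0, so propositional
-- equality of pairs is equality of real numbers.

record ℤα : Set where
  constructor _+_α
  field
    re : ℤ
    im : ℤ
open ℤα public

ι : ℕ → ℤα
ι k = (+ k) + (+ 0) α

αel : ℤα
αel = (+ 0) + (+ 1) α

zeroα : ℤα
zeroα = (+ 0) + (+ 0) α

negα : ℤα → ℤα
negα (a + b α) = (- a) + (- b) α

subα : ℤα → ℤα → ℤα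
subα (a + b α) (c + e α) = (a - c) + (b - e) α

-- (a + bα)(c + eα) = (ac + be) + (ae + bc + bed)α, using α² = dα + 1
mulα : ℕ → ℤα → ℤα → ℤα
mulα d (a + b α) (c + e α) =
  (a * c + b * e) + (a * e + b * c + b * e * + d) α

-- 1/α = α - d  (since α(α - d) = α² - dα = 1)
invαel : ℕ → ℤα
invαel d = (- (+ d)) + (+ 1) α

-- Positivity of the real number a + bα.  Write a + bα = (x + b√D)/2 with
-- x = 2a + bd and D = d² + 4 (not a perfect square for d ≥ 1).
Pos : ℕ → ℤα → Set
Pos d (a + b α) =
    ((+ 0 ℤ.≤ x) × (+ 0 ℤ.≤ b) × ¬ (x ≡ + 0 × b ≡ + 0))
  ⊎ ((+ 0 ℤ.≤ x) × (b ℤ.< + 0) × (b * b * D ℤ.< x * x))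
  ⊎ ((x ℤ.< + 0) × (+ 0 ℤ.< b) × (x * x ℤ.< b * b * D))
  where
    x = + 2 * a + b * + d
    D = + (d ℕ.* d ℕ.+ 4)

Neg : ℕ → ℤα → Set
Neg d z = Pos d (negα z)

diff : ℕ → List ℕ → ℕ → ℤα
diff d w n = subα (ι (row d w (suc n))) (mulα d αel (ι (row d w n)))

{-# OPTIONS --safe #-}
-- Every row satisfies the recurrence R (n+2) = d R (n+1) + R n of the sequence D, because
-- the value of an Ostrowski word is linear in the D_j.  Since α² = dα + 1, i.e. d − α = −1/α,
-- the recurrence gives R (n+2) − α R (n+1) = −(1/α) (R (n+1) − α R n).
-- For naturals A, B, the number A − αB has the sign of its norm A² − dAB − B² (α is the
-- positive root of x² − dx − 1).  The map (A, B) ↦ (dA + B, A) negates the norm, so the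
-- signs alternate, and the norm never vanishes because α is irrational, which is shown by
-- Vieta jumping.
module Submission where

open import Defs
open import Data.Nat using (ℕ; suc; _≤_)
open import Data.List using (List)
open import Data.Product using (_×_)
open import Data.Sum using (_⊎_)
open import Relation.Binary.PropositionalEquality using (_≡_; _≢_)

open import Data.Nat as N using (zero; z≤n; s≤s; _<_; _*_; _+_)
open import Data.Nat.Properties
open import Data.Nat.Induction using (<-rec)
open import Data.Integer as Z using (ℤ; +_; -_; +<+; -<+; +≤+)
import Data.Integer.Properties as ZP
open import Data.List using ([]; _∷_; replicate; _++_)
open import Data.Product using (_,_)
open import Data.Sum using (inj₁; inj₂; reduce)
open import Data.Empty using (⊥-elim)
open import Relation.Nullary using (¬_; contradiction)
open import Relation.Binary.PropositionalEquality
  using (refl; sym; trans; cong; cong₂; subst; subst₂; module ≡-Reasoning)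
open import Relation.Binary.Definitions using (tri<; tri≈; tri>)
import Data.Nat.Tactic.RingSolver as ℕ-Solver
import Data.Integer.Tactic.RingSolver as ℤ-Solver

_−_α : ℕ → ℕ → ℤα
A − B α = (+ A) + (- (+ B)) α

valueFrom-replicate-0 : ∀ d j n w → valueFrom d j (replicate n 0 ++ w) ≡ valueFrom d (n + j) w
valueFrom-replicate-0 d j zero    w = refl
valueFrom-replicate-0 d j (suc n) w =
  trans (valueFrom-replicate-0 d (suc j) n w) (cong (λ i → valueFrom d i w) (+-suc n j))

row-suc : ∀ d w m → row d w (suc m) ≡ valueFrom d (suc m) w
row-suc d w m = trans (valueFrom-replicate-0 d 1 m w) (cong (λ i → valueFrom d i w) (+-comm m 1))

valueFrom-recurrence : ∀ d w j →
  valueFrom d (suc (suc j)) w ≡ d * valueFrom d (suc j) w + valueFrom d j w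
valueFrom-recurrence d []       j = sym (trans (+-identityʳ _) (*-zeroʳ d))
valueFrom-recurrence d (x ∷ xs) j
  rewrite valueFrom-recurrence d xs (suc j) =
    linearity x d (Dseq d (suc j)) (Dseq d j) (valueFrom d (suc (suc j)) xs) (valueFrom d (suc j) xs)
  where
  linearity : ∀ x d a b u v → x * (d * a + b) + (d * u + v) ≡ d * (x * a + u) + (x * b + v)
  linearity = ℕ-Solver.solve-∀

Dseq-suc-nonzero : ∀ d → 1 ≤ d → ∀ j → Dseq d (suc j) ≢ 0
Dseq-suc-nonzero d 1≤d zero    ()
Dseq-suc-nonzero d 1≤d (suc j) eq with m*n≡0⇒m≡0∨n≡0 d (m+n≡0⇒m≡0 (d * Dseq d (suc j)) eq)
... | inj₁ d≡0 = <⇒≢ 1≤d (sym d≡0)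
... | inj₂ D≡0 = Dseq-suc-nonzero d 1≤d j D≡0

valueFrom-nonzero : ∀ d → 1 ≤ d → ∀ j w → LastNonzero w → valueFrom d (suc j) w ≢ 0
valueFrom-nonzero d 1≤d j (x ∷ []) x≢0 eq
  with m*n≡0⇒m≡0∨n≡0 x (m+n≡0⇒m≡0 (x * Dseq d (suc j)) eq)
... | inj₁ x≡0 = x≢0 x≡0
... | inj₂ D≡0 = Dseq-suc-nonzero d 1≤d j D≡0
valueFrom-nonzero d 1≤d j (x ∷ y ∷ ys) lastNonzero eq =
  valueFrom-nonzero d 1≤d (suc j) (y ∷ ys) lastNonzero (m+n≡0⇒n≡0 (x * Dseq d (suc j)) eq)

subα-ι-mulα-αel : ∀ d A B → subα (ι A) (mulα d αel (ι B)) ≡ A − B α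
subα-ι-mulα-αel d A B = cong₂ _+_α (re-part (+ A) (+ B)) (im-part (+ B) (+ d))
  where
  re-part : ∀ (a b : ℤ) → a Z.- (+ 0 Z.* b Z.+ + 1 Z.* + 0) ≡ a
  re-part = ℤ-Solver.solve-∀
  im-part : ∀ (b e : ℤ) → + 0 Z.- (+ 0 Z.* + 0 Z.+ + 1 Z.* b Z.+ + 1 Z.* + 0 Z.* e) ≡ - b
  im-part = ℤ-Solver.solve-∀

diff-suc : ∀ d w k → diff d w (suc k) ≡ valueFrom d (suc (suc k)) w − valueFrom d (suc k) w α
diff-suc d w k = trans
  (cong₂ (λ a b → subα (ι a) (mulα d αel (ι b))) (row-suc d w (suc k)) (row-suc d w k))
  (subα-ι-mulα-αel d _ _)

pos-*-+ : ∀ m n p → + (m * n + p) ≡ + m Z.* + n Z.+ + p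
pos-*-+ m n p = trans (ZP.pos-+ (m * n) p) (cong (Z._+ + p) (ZP.pos-* m n))

next-difference : ∀ d A B → (d * A + B) − A α ≡ negα (mulα d (invαel d) (A − B α))
next-difference d A B = cong₂ _+_α (trans (pos-*-+ d A B) (re-part (+ d) (+ A) (+ B)))
                                   (im-part (+ d) (+ A) (+ B))
  where
  re-part : ∀ e a b → e Z.* a Z.+ b ≡ - ((- e) Z.* a Z.+ + 1 Z.* (- b))
  re-part = ℤ-Solver.solve-∀
  im-part : ∀ e a b → - a ≡ - ((- e) Z.* (- b) Z.+ + 1 Z.* a Z.+ + 1 Z.* (- b) Z.* e)
  im-part = ℤ-Solver.solve-∀

-- A * A − normSub d A B = A² − dAB − B² is the norm of A − Bα, whose sign it shares.
normSub : ℕ → ℕ → ℕ → ℕ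
normSub d A B = d * A * B + B * B

normSub-zeroʳ : ∀ d A → normSub d A 0 ≡ 0
normSub-zeroʳ d A = trans (+-identityʳ (d * A * 0)) (*-zeroʳ (d * A))

normSub-shift : ∀ d A B → (d * A + B) * (d * A + B) ≡ d * (d * A + B) * A + normSub d A B
normSub-shift d A B = expand d A B
  where
  expand : ∀ d A B → (d * A + B) * (d * A + B) ≡ d * (d * A + B) * A + (d * A * B + B * B)
  expand = ℕ-Solver.solve-∀

normSub-flip< : ∀ d A B → normSub d A B < A * A →
  (d * A + B) * (d * A + B) < normSub d (d * A + B) A
normSub-flip< d A B lt =
  subst (_< normSub d (d * A + B) A) (sym (normSub-shift d A B)) (+-monoʳ-< (d * (d * A + B) * A) lt)

normSub-flip> : ∀ d A B → A * A < normSub d A B →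
  normSub d (d * A + B) A < (d * A + B) * (d * A + B)
normSub-flip> d A B lt =
  subst (normSub d (d * A + B) A <_) (sym (normSub-shift d A B)) (+-monoʳ-< (d * (d * A + B) * A) lt)

square≡normSub⇒d*b≤a : ∀ d a b → 0 < b → a * a ≡ normSub d a b → d * b ≤ a
square≡normSub⇒d*b≤a d a b 0<b eq = ≮⇒≥ λ a<db → <-irrefl eq (begin-strict
  a * a              ≤⟨ *-monoʳ-≤ a (<⇒≤ a<db) ⟩
  a * (d * b)        ≡⟨ rearrange a d b ⟩
  d * a * b          <⟨ m<m+n (d * a * b) (*-mono-< 0<b 0<b) ⟩
  normSub d a b      ∎)
  where
  open ≤-Reasoning
  rearrange : ∀ a d b → a * (d * b) ≡ d * a * b
  rearrange = ℕ-Solver.solve-∀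

vieta-jump : ∀ d b r → (d * b + r) * (d * b + r) ≡ normSub d (d * b + r) b → b * b ≡ normSub d b r
vieta-jump d b r eq = sym (+-cancelˡ-≡ (d * (d * b + r) * b) _ _
  (trans (sym (normSub-shift d b r)) eq))

vieta-jump-smaller : ∀ d b r → 1 ≤ d → 0 < b → b * b ≡ normSub d b r → r < b
vieta-jump-smaller d b r 1≤d 0<b eq = ≰⇒> λ b≤r → <-irrefl eq (begin-strict
  b * b              ≤⟨ *-mono-≤ b≤r b≤r ⟩
  r * r              <⟨ m<n+m (r * r) (*-mono-< (*-mono-< 1≤d 0<b) (<-≤-trans 0<b b≤r)) ⟩
  normSub d b r      ∎)
  where open ≤-Reasoning

α-irrational : ∀ d → 1 ≤ d → ∀ b a → a * a ≡ normSub d a b → b ≡ 0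
α-irrational d 1≤d = <-rec (λ b → ∀ a → a * a ≡ normSub d a b → b ≡ 0) descend
  where
  descend : ∀ b → (∀ {r} → r < b → ∀ a → a * a ≡ normSub d a r → r ≡ 0) →
            ∀ a → a * a ≡ normSub d a b → b ≡ 0
  descend zero    _  _ _  = refl
  descend (suc c) ih a eq = contradiction square≡0 λ ()
    where
    b = suc c
    r = a N.∸ d * b
    a≡d*b+r : a ≡ d * b + r
    a≡d*b+r = sym (m+[n∸m]≡n (square≡normSub⇒d*b≤a d a b (s≤s z≤n) eq))
    jumped : b * b ≡ normSub d b r
    jumped = vieta-jump d b r (subst (λ t → t * t ≡ normSub d t b) a≡d*b+r eq)
    r≡0 : r ≡ 0
    r≡0 = ih (vieta-jump-smaller d b r 1≤d (s≤s z≤n) jumped) b jumped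
    square≡0 : b * b ≡ 0
    square≡0 = trans jumped (trans (cong (normSub d b) r≡0) (normSub-zeroʳ d b))

square≡normSub⇒≡0 : ∀ d → 1 ≤ d → ∀ a b → a * a ≡ normSub d a b → a ≡ 0
square≡normSub⇒≡0 d 1≤d a b eq = reduce (m*n≡0⇒m≡0∨n≡0 a
  (trans eq (trans (cong (normSub d a) (α-irrational d 1≤d b a eq)) (normSub-zeroʳ d a))))

balance-< : ∀ {p q r s} → p + r ≡ q + s → r < s → q < p
balance-< {p} {q} {r} {s} p+r≡q+s r<s =
  +-cancelʳ-< r q p (subst (q + r <_) (sym p+r≡q+s) (+-monoʳ-< q r<s))

x-coordinate : ∀ d B P → + 2 Z.* + (d * B + P) Z.+ (- (+ B)) Z.* + d ≡ + (d * B + 2 * P)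
x-coordinate d B P = begin
  + 2 Z.* + (d * B + P) Z.+ (- (+ B)) Z.* + d     ≡⟨ cong (λ t → + 2 Z.* t Z.+ (- (+ B)) Z.* + d) (pos-*-+ d B P) ⟩
  + 2 Z.* (+ d Z.* + B Z.+ + P) Z.+ (- (+ B)) Z.* + d ≡⟨ expand (+ d) (+ B) (+ P) ⟩
  + d Z.* + B Z.+ + 2 Z.* + P                     ≡⟨ cong (λ t → + d Z.* + B Z.+ t) (sym (ZP.pos-* 2 P)) ⟩
  + d Z.* + B Z.+ + (2 * P)                       ≡⟨ sym (pos-*-+ d B (2 * P)) ⟩
  + (d * B + 2 * P)                               ∎
  where
  open ≡-Reasoning
  expand : ∀ e b p → + 2 Z.* (e Z.* b Z.+ p) Z.+ (- b) Z.* e ≡ e Z.* b Z.+ + 2 Z.* p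
  expand = ℤ-Solver.solve-∀

sign-identity : ∀ d B P →
  (d * B + 2 * P) * (d * B + 2 * P) + 4 * normSub d (d * B + P) B
  ≡ B * B * (d * d + 4) + 4 * ((d * B + P) * (d * B + P))
sign-identity d B P = expand d B P
  where
  expand : ∀ d B P →
    (d * B + 2 * P) * (d * B + 2 * P) + 4 * (d * (d * B + P) * B + B * B)
    ≡ B * B * (d * d + 4) + 4 * ((d * B + P) * (d * B + P))
  expand = ℕ-Solver.solve-∀

pos-square : ∀ X → + X Z.* + X ≡ + (X * X)
pos-square X = sym (ZP.pos-* X X)

pos-square-* : ∀ B D → + B Z.* + B Z.* + D ≡ + (B * B * D)
pos-square-* B D = trans (cong (Z._* + D) (pos-square B)) (sym (ZP.pos-* (B * B) D))

neg-square : ∀ x → (- x) Z.* (- x) ≡ x Z.* x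
neg-square = ℤ-Solver.solve-∀

neg-pos-square-* : ∀ B D → (- (+ B)) Z.* (- (+ B)) Z.* + D ≡ + (B * B * D)
neg-pos-square-* B D = trans (cong (Z._* + D) (neg-square (+ B))) (pos-square-* B D)

Pos-difference : ∀ d {A} B P → A ≡ d * B + P → normSub d A B < A * A → Pos d (A − B α)
Pos-difference d {A} zero P _ lt = inj₁ (subst (+ 0 Z.≤_) (sym x≡2A) (+≤+ z≤n) , +≤+ z≤n , x≢0)
  where
  x≡2A : + 2 Z.* + A Z.+ + 0 Z.* + d ≡ + (2 * A)
  x≡2A = trans (ZP.+-identityʳ (+ 2 Z.* + A)) (sym (ZP.pos-* 2 A))
  x≢0 : ¬ (+ 2 Z.* + A Z.+ + 0 Z.* + d ≡ + 0 × + 0 ≡ + 0)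
  x≢0 (x≡0 , _) with m*n≡0⇒m≡0∨n≡0 2 {A} (ZP.+-injective (trans (sym x≡2A) x≡0))
  ... | inj₂ A≡0 = n≮0 (subst (normSub d A 0 <_) (cong (λ t → t * t) A≡0) lt)
Pos-difference d B@(suc _) P refl lt =
  inj₂ (inj₁ (subst (+ 0 Z.≤_) (sym x≡X) (+≤+ z≤n) , -<+ ,
    subst₂ Z._<_ (sym (neg-pos-square-* B (d * d + 4)))
                 (sym (trans (cong (λ t → t Z.* t) x≡X) (pos-square X)))
                 (+<+ (balance-< (sign-identity d B P) (*-monoʳ-< 4 lt)))))
  where
  X = d * B + 2 * P
  x≡X = x-coordinate d B P

Neg-difference : ∀ d → 1 ≤ d → ∀ {A} B P → A ≡ d * B + P → A * A < normSub d A B → Neg d (A − B α)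
Neg-difference d _ {A} zero P _ lt = ⊥-elim (n≮0 (subst (A * A <_) (normSub-zeroʳ d A) lt))
Neg-difference d 1≤d B@(suc _) P refl lt =
  inj₂ (inj₂ (subst (Z._< + 0) (sym x≡-X) (ZP.neg-mono-< (+<+ X>0)) , +<+ (s≤s z≤n) ,
    subst₂ Z._<_ (sym (trans (cong (λ t → t Z.* t) x≡-X) (trans (neg-square (+ X)) (pos-square X))))
                 (sym (pos-square-* B (d * d + 4)))
                 (+<+ (balance-< (sym (sign-identity d B P)) (*-monoʳ-< 4 lt)))))
  where
  X = d * B + 2 * P
  X>0 : 0 < X
  X>0 = <-≤-trans (*-mono-< 1≤d (s≤s z≤n)) (m≤m+n (d * B) (2 * P))
  negate : ∀ a b e → + 2 Z.* (- a) Z.+ (- (- b)) Z.* e ≡ - (+ 2 Z.* a Z.+ (- b) Z.* e)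
  negate = ℤ-Solver.solve-∀
  x≡-X : + 2 Z.* (- (+ (d * B + P))) Z.+ + B Z.* + d ≡ - (+ X)
  x≡-X = trans (negate (+ (d * B + P)) (+ B) (+ d)) (cong -_ (x-coordinate d B P))

AlternatingStep : ℕ → ℤα → ℤα → Set
AlternatingStep d z z′ =
  (z ≢ zeroα) × ((Pos d z × Neg d z′) ⊎ (Neg d z × Pos d z′)) × (z′ ≡ negα (mulα d (invαel d) z))

alternating-step : ∀ d → 1 ≤ d → ∀ {A} B P → A ≡ d * B + P → A ≢ 0 →
  AlternatingStep d (A − B α) ((d * A + B) − A α)
alternating-step d 1≤d {A} B P A≡d*B+P A≢0 = nonzero , signs , next-difference d A B
  where
  nonzero : A − B α ≢ zeroα
  nonzero eq = A≢0 (ZP.+-injective (cong re eq))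
  signs : (Pos d (A − B α) × Neg d ((d * A + B) − A α)) ⊎ (Neg d (A − B α) × Pos d ((d * A + B) − A α))
  signs with <-cmp (normSub d A B) (A * A)
  ... | tri< lt _ _ = inj₁ (Pos-difference d B P A≡d*B+P lt , Neg-difference d 1≤d A B refl (normSub-flip< d A B lt))
  ... | tri≈ _ eq _ = contradiction (square≡normSub⇒≡0 d 1≤d A B (sym eq)) A≢0
  ... | tri> _ _ gt = inj₂ (Neg-difference d 1≤d B P A≡d*B+P gt , Pos-difference d A B refl (normSub-flip> d A B gt))

corollary1 : (d : ℕ) → 2 ≤ d → (w : List ℕ) → Trimmed d w → (n : ℕ) → 1 ≤ n →
    (diff d w n ≢ zeroα)
    × ((Pos d (diff d w n) × Neg d (diff d w (suc n))) ⊎ (Neg d (diff d w n) × Pos d (diff d w (suc n))))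
    × (diff d w (suc n) ≡ negα (mulα d (invαel d) (diff d w n)))
corollary1 d 2≤d w (_ , lastNonzero , _) (suc k) _ =
  subst₂ (AlternatingStep d) (sym (diff-suc d w k)) (sym next-diff)
    (alternating-step d 1≤d (valueFrom d (suc k) w) (valueFrom d k w)
      (valueFrom-recurrence d w k) (valueFrom-nonzero d 1≤d (suc k) w lastNonzero))
  where
  1≤d : 1 ≤ d
  1≤d = ≤-trans (s≤s z≤n) 2≤d
  next-diff : diff d w (suc (suc k))
            ≡ (d * valueFrom d (suc (suc k)) w + valueFrom d (suc k) w) − valueFrom d (suc (suc k)) w α
  next-diff = trans (diff-suc d w (suc k))
    (cong (λ A → A − valueFrom d (suc (suc k)) w α) (valueFrom-recurrence d w (suc k)))
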